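{- Let $\widehat{H}$ be a finite weakly balanced bipartite signed graph with no purely red edges, whose underlying graph $H$ is a bipartite chain graph. Then $\widehat{H}$ has a special min ordering if and only if $\widehat H$ contains none of the following three signed graphs as an induced subgraph (induced in the underlying graph, with the edge types as specified): (A) a $4$-cycle $a,b,d,c,a$ in which $ab$ and $dc$ are unicoloured and $bd$ and $ca$ are bicoloured; (B) an induced path $c,a,b,d$ in which $ca$ and $bd$ are bicoloured and $ab$ is unicoloured; (C) a graph on black vertices $a,d,e$ and white vertices $b,c,f$ whose edges are exactly $ab, ac, af, bd, df, be, ce, ef$ (i.e., $K_{3,3}$ minus the edge $cd$), where $ac, af, df$ are bicoloured and $ab, bd, be, ce, ef$ are unicoloured.
   Context: A signed graph $\widehat H$ is a graph $H$ whose edges each carry the sign $+$ (blue), $-$ (red), or both (bicoloured); an edge with exactly one sign is unicoloured. Weakly balanced: every closed walk of unicoloured edges has an even number of red edges; here $\widehat H$ has no purely red edges. Bipartite: $H$ is bipartite with parts $A,B$. A bipartite chain graph is a bipartite graph in which, within each part, the neighbourhoods of the vertices are linearly ordered by inclusion. A min ordering of a bipartite graph $H$ with parts $A,B$ is a pair of linear orders of $A$ and of $B$ such that whenever $ab, a'b'$ are edges with $a,a'\in A$, $a<a'$, $b,b'\in B$, $b'<b$, then $ab'$ is an edge. A special min ordering of $\widehat H$ is a min ordering of $H$ such that at each vertex, every neighbour joined to it by a bicoloured edge precedes every neighbour joined to it by a unicoloured edge. -}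

module Defs where

open import Data.Nat using (ℕ; zero; suc; _+_)
open import Data.Nat.Divisibility using (_∣_)
open import Data.Fin using (Fin; _<_)
open import Data.Fin.Permutation using (Permutation′; _⟨$⟩ʳ_)
open import Data.Maybe using (Maybe; just; nothing)
open import Data.Product using (_×_; Σ; ∃)
open import Data.Sum using (_⊎_; inj₁; inj₂)
open import Relation.Binary.PropositionalEquality using (_≡_; _≢_)

-- Edge colours: blue (+), red (-), or bicoloured (both signs).
data Colour : Set where
  blue red bicol : Colour

record BSG : Set where
  field
    m n : ℕ
    sg  : Fin m → Fin n → Maybe Colour
open BSG public

data Bi : Maybe Colour → Set where
  bi : Bi (just bicol)

data Uni : Maybe Colour → Set where
  uni-blue : Uni (just blue)
  uni-red  : Uni (just red)

Edge : Maybe Colour → Set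
Edge c = Σ Colour (λ k → c ≡ just k)

NoEdge : Maybe Colour → Set
NoEdge c = c ≡ nothing

transpose : BSG → BSG
transpose G = record { m = n G ; n = m G ; sg = λ b a → sg G a b }

NoPurelyRed : BSG → Set
NoPurelyRed G = ∀ a b → sg G a b ≢ just red

Vertex : BSG → Set
Vertex G = Fin (m G) ⊎ Fin (n G)

label : (G : BSG) → Vertex G → Vertex G → Maybe Colour
label G (inj₁ a) (inj₂ b) = sg G a b
label G (inj₂ b) (inj₁ a) = sg G a b
label G (inj₁ _) (inj₁ _) = nothing
label G (inj₂ _) (inj₂ _) = nothing

data UniWalk (G : BSG) : Vertex G → Vertex G → Set where
  [] : ∀ {u} → UniWalk G u u
  _∷_ : ∀ {u v w} → Uni (label G u v) → UniWalk G v w → UniWalk G u w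

redCount : ∀ {c} → Uni c → ℕ
redCount uni-blue = zero
redCount uni-red  = suc zero

reds : ∀ {G u v} → UniWalk G u v → ℕ
reds [] = zero
reds (p ∷ w) = redCount p + reds w

WeaklyBalanced : BSG → Set
WeaklyBalanced G = ∀ (v : Vertex G) (w : UniWalk G v v) → 2 ∣ reds w

_⊆N_ : ∀ {G : BSG} → Fin (m G) → Fin (m G) → Set
_⊆N_ {G} a a' = ∀ b → Edge (sg G a b) → Edge (sg G a' b)

ChainA : BSG → Set
ChainA G = ∀ (a a' : Fin (m G)) → (_⊆N_ {G} a a') ⊎ (_⊆N_ {G} a' a)

IsChainGraph : BSG → Set
IsChainGraph G = ChainA G × ChainA (transpose G)

-- Orderings. A linear order on Fin k is given by a permutation π:
-- x precedes y iff π x < π y.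

_≺[_]_ : ∀ {k} → Fin k → Permutation′ k → Fin k → Set
x ≺[ π ] y = (π ⟨$⟩ʳ x) < (π ⟨$⟩ʳ y)

IsMinOrdering : (G : BSG) → Permutation′ (m G) → Permutation′ (n G) → Set
IsMinOrdering G πA πB =
  ∀ a a' b b' → Edge (sg G a b) → Edge (sg G a' b') →
  a ≺[ πA ] a' → b' ≺[ πB ] b → Edge (sg G a b')

SpecialAtA : (G : BSG) → Permutation′ (n G) → Set
SpecialAtA G πB =
  ∀ a b b' → Bi (sg G a b) → Uni (sg G a b') → b ≺[ πB ] b'

IsSpecialMinOrdering : (G : BSG) → Permutation′ (m G) → Permutation′ (n G) → Set
IsSpecialMinOrdering G πA πB =
  IsMinOrdering G πA πB × SpecialAtA G πB × SpecialAtA (transpose G) πA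

HasSpecialMinOrdering : BSG → Set
HasSpecialMinOrdering G =
  Σ (Permutation′ (m G)) λ πA → Σ (Permutation′ (n G)) λ πB →
    IsSpecialMinOrdering G πA πB

-- Forbidden induced subgraphs, with black vertices in part A and white
-- vertices in part B.  Pairs inside a part are never adjacent (bipartite),
-- so inducedness only concerns the cross pairs, all of which are listed.

ObsA : BSG → Set
ObsA G = Σ (Fin (m G)) λ a → Σ (Fin (m G)) λ d →
         Σ (Fin (n G)) λ b → Σ (Fin (n G)) λ c →
  a ≢ d × b ≢ c ×
  Uni (sg G a b) × Bi (sg G d b) × Uni (sg G d c) × Bi (sg G a c)

ObsB : BSG → Set
ObsB G = Σ (Fin (m G)) λ a → Σ (Fin (m G)) λ d →
         Σ (Fin (n G)) λ b → Σ (Fin (n G)) λ c →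
  a ≢ d × b ≢ c ×
  Bi (sg G a c) × Uni (sg G a b) × Bi (sg G d b) × NoEdge (sg G d c)

ObsC : BSG → Set
ObsC G = Σ (Fin (m G)) λ a → Σ (Fin (m G)) λ d → Σ (Fin (m G)) λ e →
         Σ (Fin (n G)) λ b → Σ (Fin (n G)) λ c → Σ (Fin (n G)) λ f →
  (a ≢ d × a ≢ e × d ≢ e) × (b ≢ c × b ≢ f × c ≢ f) ×
  Uni (sg G a b) × Bi (sg G a c) × Bi (sg G a f) ×
  Uni (sg G d b) × NoEdge (sg G d c) × Bi (sg G d f) ×
  Uni (sg G e b) × Uni (sg G e c) × Uni (sg G e f)

ContainsObstruction : BSG → Set
ContainsObstruction G =
  ObsA G ⊎ ObsA (transpose G) ⊎ ObsB G ⊎ ObsB (transpose G) ⊎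
  ObsC G ⊎ ObsC (transpose G)

-- Rank the vertices of each part lexicographically by (number of bicoloured
-- neighbours, degree), largest first. Without (A) and (B), a unicoloured
-- neighbour of a vertex has strictly fewer bicoloured neighbours than a
-- bicoloured one, so these orders are special. If a ≺ a′, b′ ≺ b violated the min
-- property, the chain condition gives N(a) ⊊ N(a′) and N(b′) ⊊ N(b); the ranks
-- then force a bicoloured neighbour c of a that a′ lacks and a bicoloured
-- neighbour d of b′ that b lacks, and a, a′, d, b, b′, c span (C) unless (A) or
-- (B) is present. Conversely each obstruction contradicts the special min property
-- directly.
module Submission where

open import Defs
open import Relation.Nullary using (¬_; does; yes; no; _×-dec_; ¬?)
open import Function.Bundles using (_⇔_; mk⇔)

open import Data.Nat using (ℕ; suc; _+_; _*_; _≤_; _<_; z≤n; s≤s)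
open import Data.Nat.Properties
open import Data.Empty using (⊥; ⊥-elim)
open import Data.Maybe using (Maybe; just; nothing)
open import Data.Product using (Σ; ∃; _×_; _,_; proj₁; proj₂)
open import Data.Sum using (_⊎_; inj₁; inj₂; [_,_])
open import Data.Fin using (Fin; zero; punchIn; punchOut) renaming (_≟_ to _≟ᶠ_)
open import Data.Fin.Properties using (any?; punchIn-punchOut)
open import Data.Fin.Subset using (Subset; _∈_; _∉_; _⊆_; _⊂_; ∣_∣)
open import Data.Fin.Subset.Properties using (_∈?_; ∣p∣≤n; p⊆q⇒∣p∣≤∣q∣; p⊂q⇒∣p∣<∣q∣)
open import Data.Fin.Permutation using (Permutation′; insert) renaming (id to idₚ)
open import Data.Vec using (tabulate)
open import Data.Vec.Properties using (lookup∘tabulate; []=⇒lookup; lookup⇒[]=)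
open import Data.List using (allFin)
open import Data.List.Extrema ≤-totalOrder using (argmax; f[xs]≤f[argmax])
open import Data.List.Membership.Propositional.Properties using (∈-allFin)
import Data.List.Relation.Unary.All as All
open import Relation.Nullary.Decidable using (dec-true; decidable-stable)
open import Relation.Nullary.Negation using (contradiction)
open import Relation.Unary using (Pred; Decidable)
open import Relation.Binary.PropositionalEquality using (_≢_; refl; sym; trans; cong; subst₂; ≢-sym)
open import Function using (_∘_)

DescendingBy : ∀ {k} → (Fin k → ℕ) → Permutation′ k → Set
DescendingBy key π = ∀ x y → key y < key x → x ≺[ π ] y

-- Opaque because unfolding the argmax fold makes sortDescending very slow to check.
opaque
  maximumBy : ∀ {k} (key : Fin (suc k) → ℕ) → Σ (Fin (suc k)) λ i → ∀ x → key x ≤ key i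
  maximumBy {k} key =
      argmax key zero (allFin (suc k))
    , λ x → All.lookup (f[xs]≤f[argmax] {f = key} zero (allFin (suc k))) (∈-allFin x)

sortDescending : ∀ {k} (key : Fin k → ℕ) → Σ (Permutation′ k) (DescendingBy key)
sortDescending {0} key = idₚ , λ ()
sortDescending {suc k} key with maximumBy key
... | top , top-max = insert top zero π , descending
  where
  rest : Σ (Permutation′ k) (DescendingBy (key ∘ punchIn top))
  rest = sortDescending (key ∘ punchIn top)

  π : Permutation′ k
  π = proj₁ rest

  descending : DescendingBy key (insert top zero π)
  descending x y key-y<key-x with top ≟ᶠ x | top ≟ᶠ y
  ... | yes refl | yes refl = ⊥-elim (<-irrefl refl key-y<key-x)
  ... | yes refl | no _     = s≤s z≤n
  ... | no _     | yes refl = ⊥-elim (<⇒≱ key-y<key-x (top-max x))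
  ... | no x≢top | no y≢top = s≤s (proj₂ rest (punchOut x≢top) (punchOut y≢top)
          (subst₂ _<_ (sym (cong key (punchIn-punchOut y≢top)))
                      (sym (cong key (punchIn-punchOut x≢top))) key-y<key-x))

≺⇒key-≥ : ∀ {k} (key : Fin k → ℕ) {π} → DescendingBy key π →
          ∀ {x y} → x ≺[ π ] y → key y ≤ key x
≺⇒key-≥ key desc {x} {y} x≺y =
  ≮⇒≥ (λ key-x<key-y → <-asym x≺y (desc y x key-x<key-y))

lex-< : ∀ {N i j u v} → u < N → i < j → i * N + u < j * N + v
lex-< {N} {i} {j} {u} {v} u<N i<j = begin-strict
  i * N + u   <⟨ +-monoʳ-< (i * N) u<N ⟩
  i * N + N   ≡⟨ +-comm (i * N) N ⟩
  suc i * N   ≤⟨ *-monoˡ-≤ N i<j ⟩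
  j * N       ≤⟨ m≤m+n (j * N) v ⟩
  j * N + v   ∎
  where open ≤-Reasoning

toSubset : ∀ {k ℓ} {P : Pred (Fin k) ℓ} → Decidable P → Subset k
toSubset P? = tabulate (λ x → does (P? x))

module _ {k ℓ} {P : Pred (Fin k) ℓ} (P? : Decidable P) where

  ∈-toSubset⁺ : ∀ {x} → P x → x ∈ toSubset P?
  ∈-toSubset⁺ {x} px = lookup⇒[]= x _ (trans (lookup∘tabulate _ x) (dec-true (P? x) px))

  ∈-toSubset⁻ : ∀ {x} → x ∈ toSubset P? → P x
  ∈-toSubset⁻ {x} x∈ with P? x | trans (sym (lookup∘tabulate _ x)) ([]=⇒lookup x∈)
  ... | yes px | _ = px
  ... | no _   | ()

∣p∣<∣q∣⇒∃∈q∉p : ∀ {k} {p q : Subset k} → ∣ p ∣ < ∣ q ∣ → ∃ λ x → x ∈ q × x ∉ p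
∣p∣<∣q∣⇒∃∈q∉p {p = p} {q} ∣p∣<∣q∣ with any? (λ x → x ∈? q ×-dec ¬? (x ∈? p))
... | yes witness = witness
... | no ∄ = contradiction (p⊆q⇒∣p∣≤∣q∣ q⊆p) (<⇒≱ ∣p∣<∣q∣)
  where
  q⊆p : q ⊆ p
  q⊆p {x} x∈q = decidable-stable (x ∈? p) (λ x∉p → ∄ (x , x∈q , x∉p))

data LabelView : Maybe Colour → Set where
  bicoloured  : ∀ {c} → Bi c → LabelView c
  unicoloured : ∀ {c} → Uni c → LabelView c
  absent      : ∀ {c} → NoEdge c → LabelView c

view : ∀ c → LabelView c
view nothing      = absent refl
view (just blue)  = unicoloured uni-blue
view (just red)   = unicoloured uni-red
view (just bicol) = bicoloured bi

Bi⇒Edge : ∀ {c} → Bi c → Edge c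
Bi⇒Edge bi = bicol , refl

Uni⇒Edge : ∀ {c} → Uni c → Edge c
Uni⇒Edge uni-blue = blue , refl
Uni⇒Edge uni-red  = red , refl

Edge⇒¬NoEdge : ∀ {c} → Edge c → ¬ NoEdge c
Edge⇒¬NoEdge (_ , refl) ()

Edge-or-NoEdge : ∀ c → Edge c ⊎ NoEdge c
Edge-or-NoEdge nothing  = inj₂ refl
Edge-or-NoEdge (just k) = inj₁ (k , refl)

bi≢uni : ∀ {c c′} → Bi c → Uni c′ → c ≢ c′
bi≢uni bi uni-blue ()
bi≢uni bi uni-red ()

bi≢none : ∀ {c c′} → Bi c → NoEdge c′ → c ≢ c′
bi≢none bi refl ()

uni≢none : ∀ {c c′} → Uni c → NoEdge c′ → c ≢ c′
uni≢none uni-blue refl ()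
uni≢none uni-red  refl ()

bi? : Decidable Bi
bi? c with view c
... | bicoloured b  = yes b
... | unicoloured u = no λ b → bi≢uni b u refl
... | absent refl   = no λ ()

edge? : Decidable Edge
edge? c with Edge-or-NoEdge c
... | inj₁ e = yes e
... | inj₂ n = no λ e → Edge⇒¬NoEdge e n

Edge∧¬Bi⇒Uni : ∀ {c} → Edge c → ¬ Bi c → Uni c
Edge∧¬Bi⇒Uni {c} e ¬b with view c
... | bicoloured b  = contradiction b ¬b
... | unicoloured u = u
... | absent n      = contradiction n (Edge⇒¬NoEdge e)

Edge∧¬Uni⇒Bi : ∀ {c} → Edge c → ¬ Uni c → Bi c
Edge∧¬Uni⇒Bi {c} e ¬u with view c
... | bicoloured b  = b
... | unicoloured u = contradiction u ¬u
... | absent n      = contradiction n (Edge⇒¬NoEdge e)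

module _ (G : BSG) where

  ≢ᴬ : ∀ {a a′ b} → sg G a b ≢ sg G a′ b → a ≢ a′
  ≢ᴬ ne refl = ne refl

  ≢ᴮ : ∀ {a b b′} → sg G a b ≢ sg G a b′ → b ≢ b′
  ≢ᴮ ne refl = ne refl

  nbrs biNbrs : Fin (m G) → Subset (n G)
  nbrs   a = toSubset (λ b → edge? (sg G a b))
  biNbrs a = toSubset (λ b → bi? (sg G a b))

  ∈-nbrs⁺ : ∀ {a b} → Edge (sg G a b) → b ∈ nbrs a
  ∈-nbrs⁺ {a} = ∈-toSubset⁺ (λ b → edge? (sg G a b))

  ∈-nbrs⁻ : ∀ {a b} → b ∈ nbrs a → Edge (sg G a b)
  ∈-nbrs⁻ {a} = ∈-toSubset⁻ (λ b → edge? (sg G a b))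

  ∈-biNbrs⁺ : ∀ {a b} → Bi (sg G a b) → b ∈ biNbrs a
  ∈-biNbrs⁺ {a} = ∈-toSubset⁺ (λ b → bi? (sg G a b))

  ∈-biNbrs⁻ : ∀ {a b} → b ∈ biNbrs a → Bi (sg G a b)
  ∈-biNbrs⁻ {a} = ∈-toSubset⁻ (λ b → bi? (sg G a b))

  -- Lexicographic in (number of bicoloured neighbours, degree).
  rank : Fin (m G) → ℕ
  rank a = ∣ biNbrs a ∣ * suc (n G) + ∣ nbrs a ∣

  rankOrder : Permutation′ (m G)
  rankOrder = proj₁ (sortDescending rank)

  rankOrder-descending : DescendingBy rank rankOrder
  rankOrder-descending = proj₂ (sortDescending rank)

  fewerBiNbrs⇒≺ : ∀ {a a′} → ∣ biNbrs a′ ∣ < ∣ biNbrs a ∣ → a ≺[ rankOrder ] a′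
  fewerBiNbrs⇒≺ {a} {a′} fewer =
    rankOrder-descending a a′ (lex-< (s≤s (∣p∣≤n (nbrs a′))) fewer)

  ≺∧fewerNbrs⇒fewerBiNbrs : ∀ {a a′} → a ≺[ rankOrder ] a′ →
                            ∣ nbrs a ∣ < ∣ nbrs a′ ∣ → ∣ biNbrs a′ ∣ < ∣ biNbrs a ∣
  ≺∧fewerNbrs⇒fewerBiNbrs {a} {a′} a≺a′ fewer = ≰⇒> λ (bi≤ : ∣ biNbrs a ∣ ≤ ∣ biNbrs a′ ∣) →
    <⇒≱ (+-mono-≤-< (*-monoˡ-≤ (suc (n G)) bi≤) fewer)
        (≺⇒key-≥ rank {rankOrder} rankOrder-descending a≺a′)

  chain⇒⊆N : ChainA G → ∀ {a a′ b} → Edge (sg G a′ b) → NoEdge (sg G a b) → _⊆N_ {G} a a′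
  chain⇒⊆N chain {a} {a′} {b} ea′b nab with chain a a′
  ... | inj₁ a⊆a′ = a⊆a′
  ... | inj₂ a′⊆a = contradiction nab (Edge⇒¬NoEdge (a′⊆a b ea′b))

  ⊆N⇒nbrs-⊂ : ∀ {a a′ b} → _⊆N_ {G} a a′ → Edge (sg G a′ b) → NoEdge (sg G a b) →
              nbrs a ⊂ nbrs a′
  ⊆N⇒nbrs-⊂ {b = b} a⊆a′ ea′b nab =
    (λ {x} → ∈-nbrs⁺ ∘ a⊆a′ x ∘ ∈-nbrs⁻) , b , ∈-nbrs⁺ ea′b , λ b∈ → Edge⇒¬NoEdge (∈-nbrs⁻ b∈) nab

module _ (G : BSG) (noA : ¬ ObsA G) (noB : ¬ ObsB G) where

  bi-transfer : ∀ {a a′ b b′} → Bi (sg G a b) → Uni (sg G a b′) →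
               Bi (sg G a′ b′) → Bi (sg G a′ b)
  bi-transfer {a} {a′} {b} {b′} bab uab′ ba′b′ with view (sg G a′ b)
  ... | bicoloured ba′b = ba′b
  ... | unicoloured ua′b = contradiction
    (a′ , a , b , b′ , ≢ᴬ G (bi≢uni ba′b′ uab′) , ≢ᴮ G (bi≢uni bab uab′) ,
     ua′b , bab , uab′ , ba′b′) noA
  ... | absent na′b = contradiction
    (a , a′ , b′ , b , ≢ᴬ G (bi≢none bab na′b) , ≢-sym (≢ᴮ G (bi≢uni bab uab′)) ,
     bab , uab′ , ba′b′ , na′b) noB

  biNbrsᵀ-⊂ : ∀ {a b b′} → Bi (sg G a b) → Uni (sg G a b′) →
              biNbrs (transpose G) b′ ⊂ biNbrs (transpose G) b
  biNbrsᵀ-⊂ {a} bab uab′ =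
      (λ {_} → ∈-biNbrs⁺ Gᵀ ∘ bi-transfer bab uab′ ∘ ∈-biNbrs⁻ Gᵀ)
    , a , ∈-biNbrs⁺ Gᵀ bab , λ a∈ → bi≢uni (∈-biNbrs⁻ Gᵀ a∈) uab′ refl
    where
    Gᵀ : BSG
    Gᵀ = transpose G

  rankOrder-special : SpecialAtA G (rankOrder (transpose G))
  rankOrder-special a b b′ bab uab′ =
    fewerBiNbrs⇒≺ (transpose G) (p⊂q⇒∣p∣<∣q∣ (biNbrsᵀ-⊂ bab uab′))

module _ (G : BSG) (chain : ChainA G) (noA : ¬ ObsA G) (noB : ¬ ObsB G) (noC : ¬ ObsC G) where

  -- d, a, a′ / b, b′, c span (C): the labels not fixed by the hypotheses are
  -- forced by excluding (A) and (B).
  violation-obstructed : ∀ {a a′ b b′ c d} →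
    _⊆N_ {G} a a′ → _⊆N_ {transpose G} b′ b →
    Edge (sg G a b) → Edge (sg G a′ b′) → NoEdge (sg G a b′) →
    Bi (sg G a c) → ¬ Bi (sg G a′ c) → Bi (sg G d b′) → ¬ Bi (sg G d b) → ⊥
  violation-obstructed {a} {a′} {b} {b′} {c} {d} a⊆a′ b′⊆b eab ea′b′ nab′ bac ¬ba′c bdb′ ¬bdb =
    noC (d , a , a′ , b , b′ , c ,
         (≢ᴬ G (bi≢none bdb′ nab′) , ≢ᴬ G (bi≢uni bdb′ ua′b′) , ≢-sym (≢ᴬ G (uni≢none ua′b′ nab′))) ,
         (≢-sym (≢ᴮ G (bi≢uni bdb′ udb)) , ≢-sym (≢ᴮ G (bi≢uni bac uab)) , ≢-sym (≢ᴮ G (bi≢none bac nab′))) ,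
         udb , bdb′ , bdc , uab , nab′ , bac , ua′b , ua′b′ , ua′c)
    where
    ua′c : Uni (sg G a′ c)
    ua′c = Edge∧¬Bi⇒Uni (a⊆a′ c (Bi⇒Edge bac)) ¬ba′c

    udb : Uni (sg G d b)
    udb = Edge∧¬Bi⇒Uni (b′⊆b d (Bi⇒Edge bdb′)) ¬bdb

    uab : Uni (sg G a b)
    uab = Edge∧¬Bi⇒Uni eab λ bab → noB
      (d , a , b , b′ , ≢ᴬ G (bi≢none bdb′ nab′) , ≢ᴮ G (≢-sym (bi≢uni bdb′ udb)) ,
       bdb′ , udb , bab , nab′)

    ua′b′ : Uni (sg G a′ b′)
    ua′b′ = Edge∧¬Bi⇒Uni ea′b′ λ ba′b′ → noB
      (a′ , a , c , b′ , ≢ᴬ G (bi≢none ba′b′ nab′) , ≢ᴮ G (≢-sym (bi≢uni ba′b′ ua′c)) ,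
       ba′b′ , ua′c , bac , nab′)

    ua′b : Uni (sg G a′ b)
    ua′b = Edge∧¬Bi⇒Uni (a⊆a′ b eab) λ ba′b → noA
      (d , a′ , b , b′ , ≢ᴬ G (≢-sym (bi≢uni ba′b udb)) , ≢ᴮ G (≢-sym (bi≢uni bdb′ udb)) ,
       udb , ba′b , ua′b′ , bdb′)

    edc : Edge (sg G d c)
    edc with chain a d
    ... | inj₁ a⊆d = a⊆d c (Bi⇒Edge bac)
    ... | inj₂ d⊆a = contradiction nab′ (Edge⇒¬NoEdge (d⊆a b′ (Bi⇒Edge bdb′)))

    bdc : Bi (sg G d c)
    bdc = Edge∧¬Uni⇒Bi edc λ udc → noB
      (d , a , c , b′ , ≢ᴬ G (bi≢none bdb′ nab′) , ≢ᴮ G (≢-sym (bi≢uni bdb′ udc)) ,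
       bdb′ , udc , bac , nab′)

  rankOrder-isMin : ChainA (transpose G) → IsMinOrdering G (rankOrder G) (rankOrder (transpose G))
  rankOrder-isMin chainᵀ a a′ b b′ eab ea′b′ a≺a′ b′≺b with Edge-or-NoEdge (sg G a b′)
  ... | inj₁ eab′ = eab′
  ... | inj₂ nab′ =
    let (c , c∈ , c∉) = ∣p∣<∣q∣⇒∃∈q∉p (≺∧fewerNbrs⇒fewerBiNbrs G a≺a′
                          (p⊂q⇒∣p∣<∣q∣ (⊆N⇒nbrs-⊂ G a⊆a′ ea′b′ nab′)))
        (d , d∈ , d∉) = ∣p∣<∣q∣⇒∃∈q∉p (≺∧fewerNbrs⇒fewerBiNbrs Gᵀ b′≺b
                          (p⊂q⇒∣p∣<∣q∣ (⊆N⇒nbrs-⊂ Gᵀ b′⊆b eab nab′)))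
    in ⊥-elim (violation-obstructed a⊆a′ b′⊆b eab ea′b′ nab′
                 (∈-biNbrs⁻ G c∈) (c∉ ∘ ∈-biNbrs⁺ G) (∈-biNbrs⁻ Gᵀ d∈) (d∉ ∘ ∈-biNbrs⁺ Gᵀ))
    where
    Gᵀ : BSG
    Gᵀ = transpose G

    a⊆a′ : _⊆N_ {G} a a′
    a⊆a′ = chain⇒⊆N G chain ea′b′ nab′

    b′⊆b : _⊆N_ {Gᵀ} b′ b
    b′⊆b = chain⇒⊆N Gᵀ chainᵀ eab nab′

transpose-smo : ∀ G → HasSpecialMinOrdering G → HasSpecialMinOrdering (transpose G)
transpose-smo G (πA , πB , isMin , specialA , specialB) =
    πB , πA
  , (λ b b′ a a′ eab ea′b′ b≺b′ a′≺a → isMin a′ a b′ b ea′b′ eab a′≺a b≺b′)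
  , specialB , specialA

smo⇒¬ObsA : ∀ G → HasSpecialMinOrdering G → ¬ ObsA G
smo⇒¬ObsA G (_ , _ , _ , specialA , _) (a , d , b , c , _ , _ , uab , bdb , udc , bac) =
  <-asym (specialA a c b bac uab) (specialA d b c bdb udc)

smo⇒¬ObsB : ∀ G → HasSpecialMinOrdering G → ¬ ObsB G
smo⇒¬ObsB G (_ , _ , isMin , specialA , specialB) (a , d , b , c , _ , _ , bac , uab , bdb , ndc) =
  Edge⇒¬NoEdge (isMin d a b c (Bi⇒Edge bdb) (Bi⇒Edge bac) (specialB b d a bdb uab)
                              (specialA a c b bac uab)) ndc

smo⇒¬ObsC : ∀ G → HasSpecialMinOrdering G → ¬ ObsC G
smo⇒¬ObsC G (_ , _ , isMin , specialA , specialB)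
            (a , d , e , b , c , f , _ , _ , uab , bac , _ , udb , ndc , bdf , _ , uec , uef) =
  Edge⇒¬NoEdge (isMin d e b c (Uni⇒Edge udb) (Uni⇒Edge uec) (specialB f d e bdf uef)
                              (specialA a c b bac uab)) ndc

smo⇒obstructionFree : ∀ G → HasSpecialMinOrdering G → ¬ ContainsObstruction G
smo⇒obstructionFree G smo =
  [ smo⇒¬ObsA G smo , [ smo⇒¬ObsA Gᵀ smoᵀ , [ smo⇒¬ObsB G smo , [ smo⇒¬ObsB Gᵀ smoᵀ ,
  [ smo⇒¬ObsC G smo , smo⇒¬ObsC Gᵀ smoᵀ ] ] ] ] ]
  where
  Gᵀ : BSG
  Gᵀ = transpose G

  smoᵀ : HasSpecialMinOrdering Gᵀ
  smoᵀ = transpose-smo G smo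

obstructionFree⇒rankOrder-isSMO : ∀ G → IsChainGraph G → ¬ ContainsObstruction G →
                                  IsSpecialMinOrdering G (rankOrder G) (rankOrder (transpose G))
obstructionFree⇒rankOrder-isSMO G (chain , chainᵀ) free =
    rankOrder-isMin G chain noA noB noC chainᵀ
  , rankOrder-special G noA noB
  , rankOrder-special (transpose G) noAᵀ noBᵀ
  where
  noA : ¬ ObsA G
  noA = free ∘ inj₁

  noAᵀ : ¬ ObsA (transpose G)
  noAᵀ = free ∘ inj₂ ∘ inj₁

  noB : ¬ ObsB G
  noB = free ∘ inj₂ ∘ inj₂ ∘ inj₁

  noBᵀ : ¬ ObsB (transpose G)
  noBᵀ = free ∘ inj₂ ∘ inj₂ ∘ inj₂ ∘ inj₁

  noC : ¬ ObsC G
  noC = free ∘ inj₂ ∘ inj₂ ∘ inj₂ ∘ inj₂ ∘ inj₁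

theorem7 : (G : BSG) → WeaklyBalanced G → NoPurelyRed G → IsChainGraph G →
    HasSpecialMinOrdering G ⇔ (¬ ContainsObstruction G)
theorem7 G _ _ chainGraph = mk⇔
  (smo⇒obstructionFree G)
  (λ free → rankOrder G , rankOrder (transpose G) ,
            obstructionFree⇒rankOrder-isSMO G chainGraph free)
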